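{- Let $G$ be a graph isomorphic to one of $C_5$, the bull, the gem, the co-gem, and let $r\in(\mathbb{N}\setminus\{1\})\cup\{\infty\}$. Then the radius-$r$ flip-width of $G$ is at least $3$.
   Context: $\mathbb{N}$ is the set of positive integers. All graphs are finite, simple. For $A,B\subseteq V(G)$, $G\oplus(A,B)$ is the graph on $V(G)$ in which the adjacency of distinct $u,v$ is toggled exactly when $(u,v)\in(A\times B)\cup(B\times A)$; $G\oplus\mathcal{S}$ applies all flips in a collection $\mathcal{S}$. For a partition $\mathcal{P}$ of $V(G)$, a $\mathcal{P}$-flip is $G\oplus\mathcal{S}$ with all pairs in $\mathcal{S}$ of the form $(X,Y)$, $X,Y\in\mathcal{P}$; a $k$-flip is a $\mathcal{P}$-flip with $|\mathcal{P}|\le k$. Flipper game of radius $r\in\mathbb{N}\cup\{\infty\}$ and width $k$: $G_0=G$, the runner picks $v_0$; in round $i\ge1$ the flipper announces a $k$-flip $G_i$ of $G$, then the runner (knowing $G_i$) moves to $v_i$ reachable from $v_{i-1}$ by a path of length at most $r$ in $G_{i-1}$ (any vertex of the same component if $r=\infty$). The flipper wins when the runner's position $v_i$ is isolated in $G_i$. The radius-$r$ flip-width is the minimum $k$ such that the flipper has a winning strategy. $C_5$ is the 5-cycle; with $abcd$ an induced path and a fifth vertex $v$: the bull has $v$ adjacent exactly to $b,c$; the gem has $v$ adjacent to all of $a,b,c,d$; the co-gem has $v$ isolated. -}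

module Defs where

open import Data.Nat using (ℕ; zero; suc; _≤_)
open import Data.Fin using (Fin; zero; suc; _≟_)
open import Data.Bool using (Bool; true; false; _∧_; _∨_; _xor_; if_then_else_)
open import Data.Bool.Properties using (∨-comm)
open import Data.List using (List; []; _∷_)
open import Data.Product using (Σ; _×_; _,_)
open import Data.Sum using (_⊎_)
open import Relation.Nullary using (¬_; does; yes; no)
open import Relation.Binary.PropositionalEquality using (_≡_; _≢_; refl; sym)
open import Function.Bundles using (_↔_; Inverse)

-- Adjacency "matrices" on n vertices. Only entries for distinct u, v matter.
Adj : ℕ → Set
Adj n = Fin n → Fin n → Bool

record Graph : Set where
  field
    n      : ℕ
    adj    : Adj n
    adj-sym    : ∀ u v → adj u v ≡ adj v u
    adj-irrefl : ∀ v → adj v v ≡ false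
open Graph public

record _≅_ (G H : Graph) : Set where
  field
    bij      : Fin (n G) ↔ Fin (n H)
    preserve : ∀ u v → adj G u v ≡ adj H (Inverse.to bij u) (Inverse.to bij v)

fromEdges : (m : ℕ) → (Fin m → Fin m → Bool) → Graph
fromEdges m e = record
  { n = m
  ; adj = A
  ; adj-sym = s
  ; adj-irrefl = ir
  }
  where
  A : Adj m
  A u v = if does (u ≟ v) then false else (e u v ∨ e v u)
  s : ∀ u v → A u v ≡ A v u
  s u v with u ≟ v | v ≟ u
  ... | yes _ | yes _ = refl
  ... | yes p | no q = Data.Empty.⊥-elim (q (sym p)) where import Data.Empty
  ... | no p | yes q = Data.Empty.⊥-elim (p (sym q)) where import Data.Empty
  ... | no _ | no _ = ∨-comm (e u v) (e v u)
  ir : ∀ v → A v v ≡ false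
  ir v with v ≟ v
  ... | yes _ = refl
  ... | no q = Data.Empty.⊥-elim (q refl) where import Data.Empty

-- Vertices: a = 0, b = 1, c = 2, d = 3 (the induced path abcd), v = 4.
private
  a b c d w : Fin 5
  a = zero
  b = suc zero
  c = suc (suc zero)
  d = suc (suc (suc zero))
  w = suc (suc (suc (suc zero)))

  eqF : Fin 5 → Fin 5 → Bool
  eqF x y = does (x ≟ y)

  edge : Fin 5 → Fin 5 → Fin 5 → Fin 5 → Bool
  edge x y u v = eqF u x ∧ eqF v y

  pathE : Fin 5 → Fin 5 → Bool
  pathE u v = edge a b u v ∨ edge b c u v ∨ edge c d u v

C5 bull gem co-gem : Graph
C5 = fromEdges 5 (λ u v → pathE u v ∨ edge d w u v ∨ edge w a u v)
bull = fromEdges 5 (λ u v → pathE u v ∨ edge w b u v ∨ edge w c u v)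
gem = fromEdges 5 (λ u v → pathE u v ∨ edge w a u v ∨ edge w b u v ∨ edge w c u v ∨ edge w d u v)
co-gem = fromEdges 5 pathE

-- A partition 𝒫 with at most k parts is given by a labelling p : Fin n → Fin k
-- (parts = nonempty fibres). A collection 𝒮 of pairs of parts is a list of
-- pairs of labels.

toggles : ∀ {n k} → (Fin n → Fin k) → Fin k × Fin k → Fin n → Fin n → Bool
toggles p (X , Y) u v = (does (p u ≟ X) ∧ does (p v ≟ Y)) ∨ (does (p u ≟ Y) ∧ does (p v ≟ X))

flipWith : ∀ {n k} → Adj n → (Fin n → Fin k) → List (Fin k × Fin k) → Adj n
flipWith H p [] u v = H u v
flipWith H p (XY ∷ S) u v = toggles p XY u v xor flipWith H p S u v

data Walk {n : ℕ} (H : Adj n) : ℕ → Fin n → Fin n → Set where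
  nil  : ∀ {v} → Walk H 0 v v
  cons : ∀ {ℓ u w x} → u ≢ w → H u w ≡ true → Walk H ℓ w x → Walk H (suc ℓ) u x

data Radius : Set where
  fin : ℕ → Radius
  ∞   : Radius

Reach : ∀ {n} → Radius → Adj n → Fin n → Fin n → Set
Reach (fin m) H v u = Σ ℕ λ ℓ → ℓ ≤ m × Walk H ℓ v u
Reach ∞       H v u = Σ ℕ λ ℓ → Walk H ℓ v u

Isolated : ∀ {n} → Adj n → Fin n → Set
Isolated H v = ∀ u → u ≢ v → H v u ≡ false

-- Win G r k H v : the flipper can force a win (in finitely
-- many rounds) when the current graph is H = G_{i-1} and the runner is at
-- v = v_{i-1}: the flipper announces a k-flip G_i = G ⊕ 𝒮 of G, and for every
-- move v_i of the runner (within radius r in G_{i-1}), v_i is isolated in G_i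
-- or the flipper can again force a win from (G_i, v_i).

data Win (G : Graph) (r : Radius) (k : ℕ) : Adj (n G) → Fin (n G) → Set where
  step : ∀ {H v} (p : Fin (n G) → Fin k) (S : List (Fin k × Fin k)) →
         (∀ u → Reach r H v u →
            Isolated (flipWith (adj G) p S) u ⊎ Win G r k (flipWith (adj G) p S) u) →
         Win G r k H v

FlipperWins : Graph → Radius → ℕ → Set
FlipperWins G r k = ∀ v₀ → Win G r k (adj G) v₀

FlipWidth≥ : Graph → Radius → ℕ → Set
FlipWidth≥ G r m = ∀ k → FlipperWins G r k → m ≤ k

-- r ∈ (ℕ ∖ {1}) ∪ {∞}, with ℕ the positive integers
AdmissibleRadius : Radius → Set
AdmissibleRadius (fin m) = 2 ≤ m
AdmissibleRadius ∞ = Data.Unit.⊤ where import Data.Unit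

{-# OPTIONS --safe #-}
-- With at most two parts, a flip of G is determined by a 2-colouring of the vertices and a choice
-- of which of the three kinds of pairs (inside either colour class, or across) to toggle, so a
-- five-vertex graph has finitely many 2-flips. A brute-force check over them exhibits a set of
-- safe vertices (all vertices, or all but the apex v of the gem and co-gem) such that in every
-- 2-flip no two distinct safe vertices are both isolated, and every non-isolated vertex has two
-- distinct safe vertices within distance 2. So a runner standing on a non-isolated vertex can
-- always move, within radius 2, to a vertex that is not isolated in the next announced flip.
-- Flip-width is an isomorphism invariant, so the four concrete graphs suffice.
module Submission where

open import Defs
open import Data.Bool using (Bool; true; false; _∧_; _∨_; _xor_)
open import Data.Bool.Properties using (∧-comm; ∨-comm; xor-assoc; xor-comm; xor-identityʳ)
  renaming (_≟_ to _≟ᴮ_)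
open import Data.Empty using (⊥; ⊥-elim)
open import Data.Fin using (Fin; suc; _≟_)
open import Data.Fin.Patterns using (0F; 4F)
open import Data.Fin.Properties using (any?; all?; ¬Fin0; 2↔Bool)
open import Data.List using (List; []; _∷_)
open import Data.Nat using (ℕ; zero; suc; _≤_; z≤n; s≤s)
open import Data.Nat.Properties using (≤-trans)
open import Data.Product using (∃; ∃₂; _×_; _,_; proj₁; proj₂)
open import Data.Sum using (_⊎_; inj₁; inj₂)
import Data.Sum as Sum
open import Data.Unit using (⊤; tt)
open import Data.Vec using (Vec; []; _∷_; lookup; tabulate)
open import Data.Vec.Properties using (lookup∘tabulate)
open import Function using (id; _∘_)
open import Function.Bundles using (Inverse; Injection; RightInverse; _↔_; _↪_; mk↪)
open import Function.Definitions using (Injective)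
open import Function.Properties.Inverse using (↔-sym; ↔⇒↣; ↔⇒↪)
open import Relation.Nullary using (¬_; Dec; yes; does; contradiction)
open import Relation.Nullary.Decidable using (from-yes; map′; ¬?; _×-dec_; _⊎-dec_; _→-dec_)
open import Level using (0ℓ)
open import Relation.Unary using (Pred; Decidable)
open import Relation.Binary.PropositionalEquality
  using (_≡_; _≢_; refl; sym; trans; cong; cong₂; ≢-sym; module ≡-Reasoning)

private
  variable
    m m′ k : ℕ
    r : Radius

Edge : Adj m → Fin m → Fin m → Set
Edge H u v = u ≢ v × H u v ≡ true

NonIsolated : Adj m → Fin m → Set
NonIsolated H v = ∃ (Edge H v)

Within₂ : Adj m → Fin m → Fin m → Set
Within₂ H v x = v ≡ x ⊎ Edge H v x ⊎ ∃ λ w → Edge H v w × Edge H w x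

isolated⇒¬nonIsolated : ∀ {H : Adj m} {v} → Isolated H v → ¬ NonIsolated H v
isolated⇒¬nonIsolated isolated (u , v≢u , Hvu) =
  contradiction (trans (sym Hvu) (isolated u (≢-sym v≢u))) λ ()

reach-≤₂ : ∀ {H : Adj m} {v x ℓ} → AdmissibleRadius r → ℓ ≤ 2 → Walk H ℓ v x → Reach r H v x
reach-≤₂ {r = fin _} admissible ℓ≤2 walk = _ , ≤-trans ℓ≤2 admissible , walk
reach-≤₂ {r = ∞}     admissible ℓ≤2 walk = _ , walk

within₂⇒reach : ∀ {H : Adj m} {v x} → AdmissibleRadius r → Within₂ H v x → Reach r H v x
within₂⇒reach adm (inj₁ refl) = reach-≤₂ adm z≤n nil
within₂⇒reach adm (inj₂ (inj₁ (v≢x , Hvx))) = reach-≤₂ adm (s≤s z≤n) (cons v≢x Hvx nil)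
within₂⇒reach adm (inj₂ (inj₂ (w , (v≢w , Hvw) , (w≢x , Hwx)))) =
  reach-≤₂ adm (s≤s (s≤s z≤n)) (cons v≢w Hvw (cons w≢x Hwx nil))

record IsInducedEmbedding (f : Fin m → Fin m′) (H : Adj m) (H′ : Adj m′) : Set where
  field
    injective : Injective _≡_ _≡_ f
    adj-preserved : ∀ x y → H x y ≡ H′ (f x) (f y)

identity-embedding : ∀ {H H′ : Adj m} → (∀ x y → H x y ≡ H′ x y) → IsInducedEmbedding id H H′
identity-embedding H≡H′ = record { injective = id ; adj-preserved = H≡H′ }

module _ {f : Fin m → Fin m′} {H : Adj m} {H′ : Adj m′} (emb : IsInducedEmbedding f H H′) where
  open IsInducedEmbedding emb

  edge-map : ∀ {u v} → Edge H u v → Edge H′ (f u) (f v)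
  edge-map {u} {v} (u≢v , Huv) = u≢v ∘ injective , trans (sym (adj-preserved u v)) Huv

  nonIsolated-map : ∀ {v} → NonIsolated H v → NonIsolated H′ (f v)
  nonIsolated-map (u , e) = f u , edge-map e

  within₂-map : ∀ {v x} → Within₂ H v x → Within₂ H′ (f v) (f x)
  within₂-map (inj₁ refl) = inj₁ refl
  within₂-map (inj₂ (inj₁ e)) = inj₂ (inj₁ (edge-map e))
  within₂-map (inj₂ (inj₂ (w , e , e′))) = inj₂ (inj₂ (f w , edge-map e , edge-map e′))

  walk-map : ∀ {ℓ u v} → Walk H ℓ u v → Walk H′ ℓ (f u) (f v)
  walk-map nil = nil
  walk-map (cons u≢w Huw walk) with edge-map (u≢w , Huw)
  ... | fu≢fw , H′fufw = cons fu≢fw H′fufw (walk-map walk)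

  reach-map : ∀ {u v} → Reach r H u v → Reach r H′ (f u) (f v)
  reach-map {r = fin _} (ℓ , ℓ≤r , walk) = ℓ , ℓ≤r , walk-map walk
  reach-map {r = ∞}     (ℓ , walk)       = ℓ , walk-map walk

  isolated-pullback : ∀ {v} → Isolated H′ (f v) → Isolated H v
  isolated-pullback {v} isolated u u≢v =
    trans (adj-preserved v u) (isolated (f u) (u≢v ∘ injective))

  flipWith-embedding : ∀ (p : Fin m′ → Fin k) S →
    IsInducedEmbedding f (flipWith H (p ∘ f) S) (flipWith H′ p S)
  flipWith-embedding p S = record { injective = injective ; adj-preserved = preserved S }
    where
    preserved : ∀ S x y → flipWith H (p ∘ f) S x y ≡ flipWith H′ p S (f x) (f y)
    preserved []       x y = adj-preserved x y
    preserved (XY ∷ S) x y = cong (toggles p XY (f x) (f y) xor_) (preserved S x y)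

module _ {G H : Graph} (G≅H : G ≅ H) where
  open _≅_ G≅H using (bij; preserve)

  private
    H↔G : Fin (n H) ↔ Fin (n G)
    H↔G = ↔-sym bij

    φ : Fin (n H) → Fin (n G)
    φ = Inverse.to H↔G

    φ-embedding : IsInducedEmbedding φ (adj H) (adj G)
    φ-embedding = record
      { injective = Injection.injective (↔⇒↣ H↔G)
      ; adj-preserved = λ x y → begin
          adj H x y
            ≡⟨ sym (cong₂ (adj H) (Inverse.strictlyInverseˡ bij x) (Inverse.strictlyInverseˡ bij y)) ⟩
          adj H (Inverse.to bij (φ x)) (Inverse.to bij (φ y))
            ≡⟨ sym (preserve (φ x) (φ y)) ⟩
          adj G (φ x) (φ y) ∎
      }
      where open ≡-Reasoning

    win-pullback : ∀ {K K′ v} → IsInducedEmbedding φ K′ K → Win G r k K (φ v) → Win H r k K′ v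
    win-pullback {r = r} {k = k} {K′ = K′} {v} K′↪K (step p S respond) = step (p ∘ φ) S respond′
      where
      flip-embedding : IsInducedEmbedding φ (flipWith (adj H) (p ∘ φ) S) (flipWith (adj G) p S)
      flip-embedding = flipWith-embedding φ-embedding p S
      respond′ : ∀ u → Reach r K′ v u →
        Isolated (flipWith (adj H) (p ∘ φ) S) u ⊎ Win H r k (flipWith (adj H) (p ∘ φ) S) u
      respond′ u reach with respond (φ u) (reach-map K′↪K reach)
      ... | inj₁ isolated = inj₁ (isolated-pullback flip-embedding isolated)
      ... | inj₂ win      = inj₂ (win-pullback flip-embedding win)

  flipperWins-≅ : FlipperWins G r k → FlipperWins H r k
  flipperWins-≅ wins v₀ = win-pullback φ-embedding (wins (φ v₀))

  flipWidth≥-≅ : ∀ {w} → FlipWidth≥ H r w → FlipWidth≥ G r w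
  flipWidth≥-≅ width k wins = width k (flipperWins-≅ wins)

Pattern : Set
Pattern = Vec Bool 3

-- σ lists whether pairs inside the part false, across the two parts, inside the part true are toggled.
toggled : Pattern → Bool → Bool → Bool
toggled (t ∷ _ ∷ _ ∷ []) false false = t
toggled (_ ∷ t ∷ _ ∷ []) false true  = t
toggled (_ ∷ t ∷ _ ∷ []) true  false = t
toggled (_ ∷ _ ∷ t ∷ []) true  true  = t

twoFlip : Adj m → Vec Bool m → Pattern → Adj m
twoFlip A c σ x y = A x y xor toggled σ (lookup c x) (lookup c y)

IsTwoFlip : Adj m → Adj m → Set
IsTwoFlip {m} A H = ∃₂ λ (c : Vec Bool m) σ → ∀ x y → H x y ≡ twoFlip A c σ x y

flips : List (Fin k × Fin k) → Fin k → Fin k → Bool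
flips []       i j = false
flips (XY ∷ S) i j = toggles id XY i j xor flips S i j

flipWith≡xor-flips : ∀ (A : Adj m) (p : Fin m → Fin k) S u v →
  flipWith A p S u v ≡ A u v xor flips S (p u) (p v)
flipWith≡xor-flips A p []       u v = sym (xor-identityʳ (A u v))
flipWith≡xor-flips A p (XY ∷ S) u v = begin
  t xor flipWith A p S u v    ≡⟨ cong (t xor_) (flipWith≡xor-flips A p S u v) ⟩
  t xor (A u v xor f)         ≡⟨ sym (xor-assoc t (A u v) f) ⟩
  (t xor A u v) xor f         ≡⟨ cong (_xor f) (xor-comm t (A u v)) ⟩
  (A u v xor t) xor f         ≡⟨ xor-assoc (A u v) t f ⟩
  A u v xor (t xor f)         ∎
  where
  open ≡-Reasoning
  t f : Bool
  t = toggles p XY u v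
  f = flips S (p u) (p v)

flips-sym : ∀ (S : List (Fin k × Fin k)) i j → flips S i j ≡ flips S j i
flips-sym []             i j = refl
flips-sym ((X , Y) ∷ S) i j = cong₂ _xor_ toggles-sym (flips-sym S i j)
  where
  toggles-sym : toggles id (X , Y) i j ≡ toggles id (X , Y) j i
  toggles-sym = trans (∨-comm (does (i ≟ X) ∧ does (j ≟ Y)) (does (i ≟ Y) ∧ does (j ≟ X)))
                      (cong₂ _∨_ (∧-comm (does (i ≟ Y)) (does (j ≟ X)))
                                 (∧-comm (does (i ≟ X)) (does (j ≟ Y))))

module _ (parts : Fin k ↪ Bool) where
  open RightInverse parts renaming (to to part; from to representative)

  patternOf : List (Fin k × Fin k) → Pattern
  patternOf S = flips S (representative false) (representative false)
              ∷ flips S (representative false) (representative true)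
              ∷ flips S (representative true) (representative true) ∷ []

  flips≡toggled : ∀ S b b′ →
    flips S (representative b) (representative b′) ≡ toggled (patternOf S) b b′
  flips≡toggled S false false = refl
  flips≡toggled S false true  = refl
  flips≡toggled S true  false = flips-sym S _ _
  flips≡toggled S true  true  = refl

  flipWith-isTwoFlip : ∀ (A : Adj m) (p : Fin m → Fin k) S → IsTwoFlip A (flipWith A p S)
  flipWith-isTwoFlip {m} A p S = c , patternOf S , λ u v → begin
    flipWith A p S u v
      ≡⟨ flipWith≡xor-flips A p S u v ⟩
    A u v xor flips S (p u) (p v)
      ≡⟨ cong₂ (λ i j → A u v xor flips S i j)
               (sym (strictlyInverseʳ (p u))) (sym (strictlyInverseʳ (p v))) ⟩
    A u v xor flips S (representative (part (p u))) (representative (part (p v)))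
      ≡⟨ cong (A u v xor_) (flips≡toggled S (part (p u)) (part (p v))) ⟩
    A u v xor toggled (patternOf S) (part (p u)) (part (p v))
      ≡⟨ sym (cong₂ (λ b b′ → A u v xor toggled (patternOf S) b b′)
                    (lookup∘tabulate (part ∘ p) u) (lookup∘tabulate (part ∘ p) v)) ⟩
    twoFlip A c (patternOf S) u v ∎
    where
    open ≡-Reasoning
    c : Vec Bool m
    c = tabulate (part ∘ p)

NoIsolatedSafePair : Pred (Fin m) 0ℓ → Adj m → Set
NoIsolatedSafePair Safe H = ∀ x y → x ≢ y → Safe x → Safe y → NonIsolated H x ⊎ NonIsolated H y

Escapes : Pred (Fin m) 0ℓ → Adj m → Set
Escapes Safe H = ∀ v → NonIsolated H v →
  ∃₂ λ x y → x ≢ y × Safe x × Safe y × Within₂ H v x × Within₂ H v y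

record Trap (G : Graph) (Safe : Pred (Fin (n G)) 0ℓ) : Set where
  field
    nonIsolated-vertex : ∃ (NonIsolated (adj G))
    no-isolated-safe-pair : ∀ {H} → IsTwoFlip (adj G) H → NoIsolatedSafePair Safe H
    escapes : ∀ {H} → IsTwoFlip (adj G) H → Escapes Safe H

module _ {G : Graph} {Safe : Pred (Fin (n G)) 0ℓ} (trap : Trap G Safe)
         (admissible : AdmissibleRadius r) (parts : Fin k ↪ Bool) where
  open Trap trap

  -- Of the two safe vertices the runner can reach, one is not isolated in the next flip.
  runner-survives : ∀ {H v} → IsTwoFlip (adj G) H → NonIsolated H v → ¬ Win G r k H v
  runner-survives {H} {v} H-flip v-active (step p S respond) = choose (escapes H-flip v v-active)
    where
    next-flip : IsTwoFlip (adj G) (flipWith (adj G) p S)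
    next-flip = flipWith-isTwoFlip parts (adj G) p S

    move : ∀ {z} → Within₂ H v z → NonIsolated (flipWith (adj G) p S) z → ⊥
    move {z} z-near z-active with respond z (within₂⇒reach {r = r} admissible z-near)
    ... | inj₁ isolated = isolated⇒¬nonIsolated {H = flipWith (adj G) p S} isolated z-active
    ... | inj₂ win      = runner-survives next-flip z-active win

    choose : ∃₂ (λ x y → x ≢ y × Safe x × Safe y × Within₂ H v x × Within₂ H v y) → ⊥
    choose (x , y , x≢y , x-safe , y-safe , x-near , y-near)
      with no-isolated-safe-pair next-flip x y x≢y x-safe y-safe
    ... | inj₁ x-active = move x-near x-active
    ... | inj₂ y-active = move y-near y-active

  flipper-loses : ¬ FlipperWins G r k
  flipper-loses wins =
    runner-survives start-flip (proj₂ nonIsolated-vertex) (wins (proj₁ nonIsolated-vertex))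
    where
    start-flip : IsTwoFlip (adj G) (adj G)
    start-flip = flipWith-isTwoFlip parts (adj G) (λ _ → RightInverse.from parts false) []

1↪Bool : Fin 1 ↪ Bool
1↪Bool = mk↪ {to = λ _ → false} {from = λ _ → 0F} λ { {x = 0F} _ → refl ; {x = suc ()} _ }

trap⇒flipWidth≥3 : ∀ {G Safe} → Trap G Safe → AdmissibleRadius r → FlipWidth≥ G r 3
trap⇒flipWidth≥3 trap adm 0 wins with Trap.nonIsolated-vertex trap
... | v₀ , _ with wins v₀
...   | step p _ _ = ⊥-elim (¬Fin0 (p v₀))
trap⇒flipWidth≥3 trap adm 1 wins = ⊥-elim (flipper-loses trap adm 1↪Bool wins)
trap⇒flipWidth≥3 trap adm 2 wins = ⊥-elim (flipper-loses trap adm (↔⇒↪ 2↔Bool) wins)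
trap⇒flipWidth≥3 trap adm (suc (suc (suc k))) wins = s≤s (s≤s (s≤s z≤n))

∀-vec? : ∀ {P : Vec Bool m → Set} → (∀ c → Dec (P c)) → Dec (∀ c → P c)
∀-vec? {zero}  P? = map′ (λ { P[] [] → P[] }) (λ ∀P → ∀P []) (P? [])
∀-vec? {suc m} {P} P? =
  map′ both (λ ∀P → ∀P ∘ (false ∷_) , ∀P ∘ (true ∷_))
       (∀-vec? (P? ∘ (false ∷_)) ×-dec ∀-vec? (P? ∘ (true ∷_)))
  where
  both : (∀ c → P (false ∷ c)) × (∀ c → P (true ∷ c)) → ∀ c → P c
  both (P-false , _) (false ∷ c) = P-false c
  both (_ , P-true)  (true ∷ c)  = P-true c

edge? : ∀ (H : Adj m) u v → Dec (Edge H u v)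
edge? H u v = ¬? (u ≟ v) ×-dec (H u v ≟ᴮ true)

nonIsolated? : ∀ (H : Adj m) v → Dec (NonIsolated H v)
nonIsolated? H v = any? (edge? H v)

within₂? : ∀ (H : Adj m) v x → Dec (Within₂ H v x)
within₂? H v x = (v ≟ x) ⊎-dec edge? H v x ⊎-dec any? (λ w → edge? H v w ×-dec edge? H w x)

module _ {Safe : Pred (Fin m) 0ℓ} (safe? : Decidable Safe) where

  noIsolatedSafePair? : ∀ H → Dec (NoIsolatedSafePair Safe H)
  noIsolatedSafePair? H = all? λ x → all? λ y →
    ¬? (x ≟ y) →-dec safe? x →-dec safe? y →-dec (nonIsolated? H x ⊎-dec nonIsolated? H y)

  escapes? : ∀ H → Dec (Escapes Safe H)
  escapes? H = all? λ v → nonIsolated? H v →-dec any? λ x → any? λ y →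
    ¬? (x ≟ y) ×-dec safe? x ×-dec safe? y ×-dec within₂? H v x ×-dec within₂? H v y

NormalFormCheck : (G : Graph) → Pred (Fin (n G)) 0ℓ → Set
NormalFormCheck G Safe =
  ∃ (NonIsolated (adj G)) ×
  (∀ c σ → NoIsolatedSafePair Safe (twoFlip (adj G) c σ)) ×
  (∀ c σ → Escapes Safe (twoFlip (adj G) c σ))

normalFormCheck? : ∀ G {Safe} → Decidable Safe → Dec (NormalFormCheck G Safe)
normalFormCheck? G safe? =
  any? (nonIsolated? (adj G)) ×-dec
  ∀-vec? (λ c → ∀-vec? λ σ → noIsolatedSafePair? safe? (twoFlip (adj G) c σ)) ×-dec
  ∀-vec? (λ c → ∀-vec? λ σ → escapes? safe? (twoFlip (adj G) c σ))

trap-from-normal-forms : ∀ {G Safe} → NormalFormCheck G Safe → Trap G Safe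
trap-from-normal-forms {G} {Safe} (start , pairs , escape) = record
  { nonIsolated-vertex = start
  ; no-isolated-safe-pair = no-isolated-safe-pair
  ; escapes = escapes
  }
  where
  no-isolated-safe-pair : ∀ {H} → IsTwoFlip (adj G) H → NoIsolatedSafePair Safe H
  no-isolated-safe-pair {H} (c , σ , H≡) x y x≢y x-safe y-safe =
    Sum.map (nonIsolated-map to-H) (nonIsolated-map to-H) (pairs c σ x y x≢y x-safe y-safe)
    where
    to-H : IsInducedEmbedding id (twoFlip (adj G) c σ) H
    to-H = identity-embedding (λ x y → sym (H≡ x y))

  escapes : ∀ {H} → IsTwoFlip (adj G) H → Escapes Safe H
  escapes {H} (c , σ , H≡) v v-active
    with escape c σ v (nonIsolated-map (identity-embedding H≡) v-active)
  ... | x , y , x≢y , x-safe , y-safe , x-near , y-near =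
    x , y , x≢y , x-safe , y-safe , within₂-map to-H x-near , within₂-map to-H y-near
    where
    to-H : IsInducedEmbedding id (twoFlip (adj G) c σ) H
    to-H = identity-embedding (λ x y → sym (H≡ x y))

C5-trap : Trap C5 (λ _ → ⊤)
C5-trap = trap-from-normal-forms (from-yes (normalFormCheck? C5 (λ _ → yes tt)))

bull-trap : Trap bull (λ _ → ⊤)
bull-trap = trap-from-normal-forms (from-yes (normalFormCheck? bull (λ _ → yes tt)))

gem-trap : Trap gem (_≢ 4F)
gem-trap = trap-from-normal-forms (from-yes (normalFormCheck? gem (λ x → ¬? (x ≟ 4F))))

co-gem-trap : Trap co-gem (_≢ 4F)
co-gem-trap = trap-from-normal-forms (from-yes (normalFormCheck? co-gem (λ x → ¬? (x ≟ 4F))))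

theorem3p6 : (G : Graph) →
    (G ≅ C5) ⊎ (G ≅ bull) ⊎ (G ≅ gem) ⊎ (G ≅ co-gem) →
    (r : Radius) → AdmissibleRadius r →
    FlipWidth≥ G r 3
theorem3p6 G (inj₁ G≅C5)               r adm = flipWidth≥-≅ G≅C5 (trap⇒flipWidth≥3 C5-trap adm)
theorem3p6 G (inj₂ (inj₁ G≅bull))       r adm = flipWidth≥-≅ G≅bull (trap⇒flipWidth≥3 bull-trap adm)
theorem3p6 G (inj₂ (inj₂ (inj₁ G≅gem))) r adm = flipWidth≥-≅ G≅gem (trap⇒flipWidth≥3 gem-trap adm)
theorem3p6 G (inj₂ (inj₂ (inj₂ G≅co-gem))) r adm =
  flipWidth≥-≅ G≅co-gem (trap⇒flipWidth≥3 co-gem-trap adm)
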